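{- Let $n\ge 1$ and $k\ge n$ be integers. Then $\|A_{k,n}-C_{k,n}\| < n\left(\frac{2n}{ek}\right)^{n/2}$.
   Context: For $\pi\in S_n$: $d(\pi)$ is the number of descents ($i\in\{1,\dots,n-1\}$ with $\pi(i)>\pi(i+1)$); $cd(\pi)=d(\pi)+1$ if $\pi(n)>\pi(1)$ and $cd(\pi)=d(\pi)$ otherwise (number of cyclic descents); $maj(\pi)$ is the major index, the sum of those $i\in\{1,\dots,n-1\}$ with $\pi(i)>\pi(i+1)$. $C_r(m)=\sum_{1\le l\le r,\ \gcd(l,r)=1}e^{2\pi i lm/r}$ is the Ramanujan sum. The cut-then-shuffle measure is $C_{k,n}(\pi)=\binom{n+k-cd(\pi)-1}{n-1}/(nk^{n-1})$. The affine $k$-shuffle measure $A_{k,n}$ on $S_n$ is \[A_{k,n}(\pi)=\begin{cases}\frac{1}{nk^{n-1}}\sum_{r\mid n,\ r\mid k-cd(\pi)}\binom{\frac{n+k-cd(\pi)-r}{r}}{\frac{n-r}{r}}C_r(-maj(\pi)) & \text{if } k-cd(\pi)>0,\\ \frac{1}{k^{n-1}} & \text{if } k=cd(\pi) \text{ and } n\mid maj(\pi),\\ 0 & \text{otherwise},\end{cases}\] where the sum is over positive integers $r$ dividing both $n$ and $k-cd(\pi)$. The total variation distance is $\|P-Q\|=\frac12\sum_{\pi\in S_n}|P(\pi)-Q(\pi)|$. -}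

module Defs where

open import Data.Bool using (Bool; true; false; if_then_else_)
open import Data.Nat as ℕ using (ℕ; zero; suc; _∸_; _<ᵇ_; _≡ᵇ_)
open import Data.Nat.Divisibility using (_∣?_)
open import Data.Nat.Combinatorics using (_C_)
open import Data.Integer as ℤ using (ℤ; +_; _%ℕ_)
open import Data.Rational as ℚ using (ℚ; 0ℚ; 1ℚ)
open import Data.List using (List; []; _∷_; map; concatMap; filter; length; upTo; foldr)
open import Data.Nat.ListAction using (sum)
open import Data.List.Relation.Unary.Unique.DecPropositional ℕ._≟_ using (unique?)
open import Relation.Nullary using (does)
open import Data.Product using (∃-syntax; _×_)

-- z / d as a rational, with the convention z / 0 = 0 (never used with d = 0
-- in the theorem, since n ≥ 1 and k ≥ 1 there).
frac : ℤ → ℕ → ℚ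
frac z zero    = 0ℚ
frac z (suc d) = z ℚ./ suc d

_^ℚ_ : ℚ → ℕ → ℚ
q ^ℚ zero  = 1ℚ
q ^ℚ suc m = q ℚ.* (q ^ℚ m)

sumℚ : List ℚ → ℚ
sumℚ = foldr ℚ._+_ 0ℚ

sumℤ : List ℤ → ℤ
sumℤ = foldr ℤ._+_ (+ 0)

oneTo : ℕ → List ℕ
oneTo m = map suc (upTo m)

-- The symmetric group S_n: all injective words of length n over {0,…,n-1}
-- (one-line notation π(1) … π(n), values shifted down by 1; only
-- comparisons of values matter below).

words : ℕ → ℕ → List (List ℕ)
words a zero    = [] ∷ []
words a (suc l) = concatMap (λ x → map (x ∷_) (words a l)) (upTo a)

Sn : ℕ → List (List ℕ)
Sn n = filter unique? (words n n)

-- Descent statistics (positions are 1-indexed)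

descentSet : ℕ → List ℕ → List ℕ
descentSet i []           = []
descentSet i (x ∷ [])     = []
descentSet i (x ∷ y ∷ xs) =
  if y <ᵇ x then i ∷ descentSet (suc i) (y ∷ xs) else descentSet (suc i) (y ∷ xs)

des : List ℕ → ℕ
des π = length (descentSet 1 π)

maj : List ℕ → ℕ
maj π = sum (descentSet 1 π)

lastOr : ℕ → List ℕ → ℕ
lastOr d []       = d
lastOr d (x ∷ xs) = lastOr x xs

cdes : List ℕ → ℕ
cdes []       = 0
cdes (x ∷ xs) = des (x ∷ xs) ℕ.+ (if x <ᵇ lastOr x xs then 1 else 0)

-- Ramanujan sum C_r(m) = Σ_{1≤l≤r, gcd(l,r)=1} e^{2πi lm/r}.
-- Grouping l ∈ {1,…,r} by gcd(l,r) gives Σ_{d ∣ r} C_d(m) = Σ_{l=1}^r e^{2πi lm/r}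
-- = r·[r ∣ m]; this determines C_r(m) recursively (first argument = fuel ≥ r).

ramanujanF : ℕ → ℕ → ℤ → ℤ
ramanujanF zero    r m = + 0
ramanujanF (suc f) zero m = + 0
ramanujanF (suc f) (suc r) m =
  (if (m %ℕ suc r) ≡ᵇ 0 then + suc r else + 0)
  ℤ.- sumℤ (map (λ d → if does (d ∣? suc r) then ramanujanF f d m else + 0) (oneTo r))

ramanujan : ℕ → ℤ → ℤ
ramanujan r m = ramanujanF r r m

cutShuffle : ℕ → ℕ → List ℕ → ℚ
cutShuffle k n π =
  frac (+ ((n ℕ.+ k ∸ cdes π ∸ 1) C (n ∸ 1))) (n ℕ.* (k ℕ.^ (n ∸ 1)))

affineTerm : ℕ → ℕ → List ℕ → ℕ → ℤ
affineTerm k n π zero    = + 0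
affineTerm k n π (suc r) =
  if does (suc r ∣? n) Data.Bool.∧ does (suc r ∣? (k ∸ cdes π))
  then (+ (ℕ._/_ (n ℕ.+ (k ∸ cdes π) ∸ suc r) (suc r)
            C ℕ._/_ (n ∸ suc r) (suc r)))
       ℤ.* ramanujan (suc r) (ℤ.- (+ maj π))
  else + 0

affineShuffle : ℕ → ℕ → List ℕ → ℚ
affineShuffle k n π =
  if cdes π <ᵇ k
  then frac (sumℤ (map (affineTerm k n π) (oneTo n))) (n ℕ.* (k ℕ.^ (n ∸ 1)))
  else (if (k ≡ᵇ cdes π) Data.Bool.∧ ((maj π ℕ.% suc (n ∸ 1)) ≡ᵇ 0)
        then frac (+ 1) (k ℕ.^ (n ∸ 1))
        else 0ℚ)

tvDist : ℕ → (List ℕ → ℚ) → (List ℕ → ℚ) → ℚ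
tvDist n P Q = frac (+ 1) 2 ℚ.* sumℚ (map (λ π → ℚ.∣ P π ℚ.- Q π ∣) (Sn n))

-- Euler's number e via rational upper approximations:
-- eUpper N = Σ_{j=0}^{N} 1/j! + 1/(N!·N)  (N ≥ 1) is strictly decreasing
-- with limit e and eUpper N > e for all N ≥ 1.

eUpper : ℕ → ℚ
eUpper N = sumℚ (map (λ j → frac (+ 1) (j ℕ.!)) (upTo (suc N)))
           ℚ.+ frac (+ 1) ((N ℕ.!) ℕ.* N)

-- For x ≥ 0:  x < n (2n/(e k))^{n/2}
--   ⇔ x² (e k)^n < n² (2n)^n
--   ⇔ ∃ N ≥ 1, x² (eUpper N · k)^n < n² (2n)^n
-- (since eUpper N ↓ e strictly from above).
LtBound : ℕ → ℕ → ℚ → Set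
LtBound n k x =
  ∃[ N ] (1 ℕ.≤ N ×
    (x ^ℚ 2) ℚ.* ((eUpper N ℚ.* frac (+ k) 1) ^ℚ n)
      ℚ.< frac (+ ((n ℕ.^ 2) ℕ.* ((2 ℕ.* n) ℕ.^ n))) 1)

{-# OPTIONS --safe #-}
-- Let d = ⌊n/2⌋ − 1. If cd(π) < k, the r = 1 summand of n k^(n−1) A_{k,n}(π) is the numerator
-- binom(n+k−cd−1, n−1) of C_{k,n}(π), so n k^(n−1) (A − C)(π) is the sum of the summands with
-- 2 ≤ r ∣ n, r ∣ k − cd. Writing n = ur and k − cd = Kr, such a summand is
-- binom(u−1+K, u−1) C_r(−maj π), a polynomial of degree u − 1 ≤ d in k: the recursive
-- definition of C_r gives |C_r| ≤ 2^r − 1, and binom(u−1+K, u−1) ≤ (k/n)^(u−1) binom(2u−1, u−1).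
-- Hence n^d |A − C|(π) ≤ k^d V(n) / (n k^(n−1)) with V(n) depending on n only; the case
-- cd(π) ≥ k, where both measures are at most 1/k^(n−1), obeys the same bound. Summing over the
-- n! permutations and using 2d + n ≤ 2(n − 1), the claim with e replaced by 49/18 > e reduces to
-- an inequality in n alone. It holds by evaluation for n < 28, and beyond that it follows from
-- V(n) ≤ n 2^(n+1) and (n!)² n 49^n < n^(2n) 9^n, proved by induction from
-- (1 + 1/n)^(2n) ≥ 49(n+1)/(9n).
module Submission where

open import Defs
open import Data.Nat
  using (ℕ; _≤_; zero; suc; _+_; _*_; _∸_; _^_; _<_; _⊔_; _/_; _%_; _!; z≤n; s≤s; _<ᵇ_; _≡ᵇ_; _<?_; _≤?_; >-nonZero)
open import Data.Nat.Properties
open import Data.Nat.DivMod using (m*n/n≡m; /-monoˡ-≤; n/1≡n; m/n*n≤m; m≡m%n+[m/n]*n; m%n<n; m≥n⇒m/n>0)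
open import Data.Nat.Divisibility using (_∣_; _∣?_; divides; 1∣_)
open import Data.Nat.Combinatorics using (_C_; nCk+nC[k+1]≡[n+1]C[k+1]; nCk≡nC[n∸k]; k>n⇒nCk≡0; nCn≡1; nC1≡n)
open import Data.Nat.ListAction using (sum)
open import Data.Nat.ListAction.Properties using (sum-++)
open import Data.Nat.Tactic.RingSolver using (solve-∀)
import Data.Integer.Tactic.RingSolver as ℤSolver
open import Data.Integer as ℤ using (ℤ; +_)
import Data.Integer.Properties as ℤ
open import Data.Integer.DivMod using (n%ℕd<d)
open import Data.Rational as ℚ using (ℚ; 0ℚ; 1ℚ)
import Data.Rational.Properties as ℚ
open import Data.Rational.Unnormalised as ℚᵘ using (mkℚᵘ; *≤*; *<*; *≡*)
import Data.Rational.Unnormalised.Properties as ℚᵘ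
open import Data.Fin using (Fin; toℕ; fromℕ<)
import Data.Fin.Properties as Fin
open import Data.List using (List; []; _∷_; [_]; map; concatMap; filter; length; upTo; drop; _++_; _∷ʳ_)
import Data.List.Properties as List
open import Data.List.Relation.Unary.All as All using (All; []; _∷_; all?)
open import Data.List.Relation.Unary.All.Properties using (map⁺; applyUpTo⁺₂)
open import Data.List.Relation.Unary.AllPairs using (_∷_)
open import Data.List.Relation.Unary.Unique.DecPropositional _≟_ using (unique?; Unique)
open import Data.List.Membership.Propositional using (_∈_)
import Data.List.Relation.Unary.Any as Any
open import Data.Bool using (true; false; if_then_else_; _∧_)
open import Data.Empty using (⊥-elim)
open import Data.Product using (_×_; _,_; proj₁; proj₂)
open import Data.Sum using (inj₁; inj₂)
open import Function using (_∘_; id)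
open import Relation.Nullary using (Dec; does; yes; no; ¬_; ¬?)
open import Relation.Nullary.Decidable using (toWitness)
open import Relation.Nullary.Reflects using (ofʸ; ofⁿ)
open import Relation.Unary using (Pred; Decidable)
open import Relation.Binary.PropositionalEquality hiding ([_])

if-does-∧ : ∀ {p q ℓ} {P : Set p} {Q : Set q} {A : Set} (R : A → Set ℓ) (p? : Dec P) (q? : Dec Q) {x y : A} →
            (P → Q → R x) → (¬ (P × Q) → R y) → R (if does p? ∧ does q? then x else y)
if-does-∧ R (yes p) (yes q) both _    = both p q
if-does-∧ R (yes _) (no ¬q) _    else = else (¬q ∘ proj₂)
if-does-∧ R (no ¬p) _       _    else = else (¬p ∘ proj₁)

if-does : ∀ {p ℓ} {P : Set p} {A : Set} (R : A → Set ℓ) (p? : Dec P) {x y : A} →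
          (P → R x) → (¬ P → R y) → R (if does p? then x else y)
if-does R (yes p) yes-case _       = yes-case p
if-does R (no ¬p) _        no-case = no-case ¬p

if-does-yes : ∀ {p} {P : Set p} {A : Set} (p? : Dec P) {x y : A} → P → (if does p? then x else y) ≡ x
if-does-yes (yes _) _ = refl
if-does-yes (no ¬p) p = ⊥-elim (¬p p)

∣sumℤ∣≤sum∣∣ : ∀ {A : Set} (f : A → ℤ) xs → ℤ.∣ sumℤ (map f xs) ∣ ≤ sum (map (ℤ.∣_∣ ∘ f) xs)
∣sumℤ∣≤sum∣∣ f []       = z≤n
∣sumℤ∣≤sum∣∣ f (x ∷ xs) =
  ≤-trans (ℤ.∣i+j∣≤∣i∣+∣j∣ (f x) (sumℤ (map f xs))) (+-monoʳ-≤ ℤ.∣ f x ∣ (∣sumℤ∣≤sum∣∣ f xs))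

sum-<-+length : ∀ {A : Set} {f g : A → ℕ} → (∀ x → f x < g x) → ∀ xs →
                sum (map f xs) + length xs ≤ sum (map g xs)
sum-<-+length f<g []       = z≤n
sum-<-+length {f = f} {g} f<g (x ∷ xs) = begin
  f x + sum (map f xs) + suc (length xs)   ≡⟨ shuffle (f x) (sum (map f xs)) (length xs) ⟩
  suc (f x) + (sum (map f xs) + length xs) ≤⟨ +-mono-≤ (f<g x) (sum-<-+length f<g xs) ⟩
  g x + sum (map g xs)                     ∎
  where
  open ≤-Reasoning
  shuffle : ∀ a b c → a + b + suc c ≡ suc a + (b + c)
  shuffle = solve-∀

∣sumℤ∣-weighted : ∀ {A : Set} {f : A → ℤ} {g : A → ℕ} {c c′} xs →
                  All (λ x → c * ℤ.∣ f x ∣ ≤ c′ * g x) xs → c * ℤ.∣ sumℤ (map f xs) ∣ ≤ c′ * sum (map g xs)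
∣sumℤ∣-weighted {c = c} []       []       = ≤-trans (≤-reflexive (*-zeroʳ c)) z≤n
∣sumℤ∣-weighted {f = f} {g} {c} {c′} (x ∷ xs) (fx≤gx ∷ fxs≤gxs) = begin
  c * ℤ.∣ f x ℤ.+ sumℤ (map f xs) ∣
    ≤⟨ *-monoʳ-≤ c (ℤ.∣i+j∣≤∣i∣+∣j∣ (f x) (sumℤ (map f xs))) ⟩
  c * (ℤ.∣ f x ∣ + ℤ.∣ sumℤ (map f xs) ∣)
    ≡⟨ *-distribˡ-+ c ℤ.∣ f x ∣ _ ⟩
  c * ℤ.∣ f x ∣ + c * ℤ.∣ sumℤ (map f xs) ∣
    ≤⟨ +-mono-≤ fx≤gx (∣sumℤ∣-weighted {f = f} {g} {c} {c′} xs fxs≤gxs) ⟩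
  c′ * g x + c′ * sum (map g xs)
    ≡⟨ *-distribˡ-+ c′ (g x) _ ⟨
  c′ * (g x + sum (map g xs)) ∎
  where open ≤-Reasoning

sum-≤-length* : ∀ {A : Set} {f : A → ℕ} {c} xs → All (λ x → f x ≤ c) xs → sum (map f xs) ≤ length xs * c
sum-≤-length* []       []                 = z≤n
sum-≤-length* (x ∷ xs) (fx≤c ∷ fxs≤c) = +-mono-≤ fx≤c (sum-≤-length* xs fxs≤c)

*-^-distrib : ∀ m n o → (m * n) ^ o ≡ m ^ o * n ^ o
*-^-distrib m n zero    = refl
*-^-distrib m n (suc o) = trans (cong (m * n *_) (*-^-distrib m n o)) (interchange m n (m ^ o) (n ^ o))
  where
  interchange : ∀ a b x y → a * b * (x * y) ≡ a * x * (b * y)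
  interchange = solve-∀

^-split : ∀ x {u d} → u ≤ d → x ^ d ≡ x ^ (d ∸ u) * x ^ u
^-split x {u} {d} u≤d = trans (cong (x ^_) (sym (m∸n+n≡m u≤d))) (^-distribˡ-+-* x (d ∸ u) u)

^-double : ∀ x d → x ^ (2 * d) ≡ x ^ d * x ^ d
^-double x d = trans (cong (λ e → x ^ (d + e)) (+-identityʳ d)) (^-distribˡ-+-* x d d)

frac-toℚᵘ : ∀ z b → ℚ.toℚᵘ (frac z (suc b)) ℚᵘ.≃ mkℚᵘ z b
frac-toℚᵘ z b = ℚ.toℚᵘ-fromℚᵘ (mkℚᵘ z b)

frac-≡-toℚᵘ : ∀ {p} z b → ℚ.toℚᵘ p ℚᵘ.≃ mkℚᵘ z b → p ≡ frac z (suc b)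
frac-≡-toℚᵘ z b p≃ = ℚ.toℚᵘ-injective (ℚᵘ.≃-trans p≃ (ℚᵘ.≃-sym (frac-toℚᵘ z b)))

frac-≤ : ∀ {a c b d} → 0 < b → 0 < d → a * d ≤ c * b → frac (+ a) b ℚ.≤ frac (+ c) d
frac-≤ {a} {c} {suc b} {suc d} _ _ ad≤cb = ℚ.toℚᵘ-cancel-≤
  (ℚᵘ.≤-respˡ-≃ (ℚᵘ.≃-sym (frac-toℚᵘ (+ a) b)) (ℚᵘ.≤-respʳ-≃ (ℚᵘ.≃-sym (frac-toℚᵘ (+ c) d))
    (*≤* (subst₂ ℤ._≤_ (ℤ.pos-* a (suc d)) (ℤ.pos-* c (suc b)) (ℤ.+≤+ ad≤cb)))))

frac-< : ∀ {a c b d} → 0 < b → 0 < d → a * d < c * b → frac (+ a) b ℚ.< frac (+ c) d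
frac-< {a} {c} {suc b} {suc d} _ _ ad<cb = ℚ.toℚᵘ-cancel-<
  (ℚᵘ.<-respˡ-≃ (ℚᵘ.≃-sym (frac-toℚᵘ (+ a) b)) (ℚᵘ.<-respʳ-≃ (ℚᵘ.≃-sym (frac-toℚᵘ (+ c) d))
    (*<* (subst₂ ℤ._<_ (ℤ.pos-* a (suc d)) (ℤ.pos-* c (suc b)) (ℤ.+<+ ad<cb)))))

frac-≡ : ∀ {a c b d} → 0 < b → 0 < d → a * d ≡ c * b → frac (+ a) b ≡ frac (+ c) d
frac-≡ 0<b 0<d ad≡cb =
  ℚ.≤-antisym (frac-≤ 0<b 0<d (≤-reflexive ad≡cb)) (frac-≤ 0<d 0<b (≤-reflexive (sym ad≡cb)))

frac-+ : ∀ x y {b} → 0 < b → frac x b ℚ.+ frac y b ≡ frac (x ℤ.+ y) b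
frac-+ x y {suc b} _ = frac-≡-toℚᵘ (x ℤ.+ y) b (ℚᵘ.≃-trans
  (ℚ.toℚᵘ-homo-+ (frac x (suc b)) (frac y (suc b)))
  (ℚᵘ.≃-trans (ℚᵘ.+-cong (frac-toℚᵘ x b) (frac-toℚᵘ y b)) (*≡* (cross x y (+ suc b)))))
  where
  cross : ∀ x y s → (x ℤ.* s ℤ.+ y ℤ.* s) ℤ.* s ≡ (x ℤ.+ y) ℤ.* (s ℤ.* s)
  cross = ℤSolver.solve-∀

frac-neg : ∀ x {b} → 0 < b → ℚ.- frac x b ≡ frac (ℤ.- x) b
frac-neg x {suc b} _ = frac-≡-toℚᵘ (ℤ.- x) b
  (ℚᵘ.≃-trans (ℚ.toℚᵘ-homo‿- (frac x (suc b))) (ℚᵘ.-‿cong (frac-toℚᵘ x b)))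

∣frac∣ : ∀ x {b} → 0 < b → ℚ.∣ frac x b ∣ ≡ frac (+ ℤ.∣ x ∣) b
∣frac∣ x {suc b} _ = frac-≡-toℚᵘ (+ ℤ.∣ x ∣) b
  (ℚᵘ.≃-trans (ℚ.toℚᵘ-homo-∣-∣ (frac x (suc b))) (ℚᵘ.∣-∣-cong (frac-toℚᵘ x b)))

∣frac-frac∣ : ∀ x y {b} → 0 < b → ℚ.∣ frac x b ℚ.- frac y b ∣ ≡ frac (+ ℤ.∣ x ℤ.- y ∣) b
∣frac-frac∣ x y {b} 0<b = begin
  ℚ.∣ frac x b ℚ.- frac y b ∣        ≡⟨ cong (λ q → ℚ.∣ frac x b ℚ.+ q ∣) (frac-neg y 0<b) ⟩
  ℚ.∣ frac x b ℚ.+ frac (ℤ.- y) b ∣  ≡⟨ cong ℚ.∣_∣ (frac-+ x (ℤ.- y) 0<b) ⟩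
  ℚ.∣ frac (x ℤ.- y) b ∣             ≡⟨ ∣frac∣ (x ℤ.- y) 0<b ⟩
  frac (+ ℤ.∣ x ℤ.- y ∣) b           ∎
  where open ≡-Reasoning

frac-* : ∀ {a c b d} → 0 < b → 0 < d → frac (+ a) b ℚ.* frac (+ c) d ≡ frac (+ (a * c)) (b * d)
frac-* {a} {c} {suc b} {suc d} _ _ = frac-≡-toℚᵘ (+ (a * c)) (d + b * suc d) (ℚᵘ.≃-trans
  (ℚ.toℚᵘ-homo-* (frac (+ a) (suc b)) (frac (+ c) (suc d)))
  (ℚᵘ.≃-trans (ℚᵘ.*-cong (frac-toℚᵘ (+ a) b) (frac-toℚᵘ (+ c) d))
    (ℚᵘ.≃-reflexive (cong (λ z → mkℚᵘ z (d + b * suc d)) (sym (ℤ.pos-* a c))))))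

frac-^ : ∀ a {b} → 0 < b → ∀ m → frac (+ a) b ^ℚ m ≡ frac (+ (a ^ m)) (b ^ m)
frac-^ a 0<b zero = refl
frac-^ a {b} 0<b (suc m) =
  trans (cong (frac (+ a) b ℚ.*_) (frac-^ a 0<b m)) (frac-* 0<b (m^n>0 b {{>-nonZero 0<b}} m))

∣frac-frac∣≤ : ∀ x y {D e W} → 0 < D → 0 < e → e * ℤ.∣ x ℤ.- y ∣ ≤ W →
               ℚ.∣ frac x D ℚ.- frac y D ∣ ℚ.≤ frac (+ W) (e * D)
∣frac-frac∣≤ x y {D} {e} {W} 0<D 0<e e∣x-y∣≤W = begin
  ℚ.∣ frac x D ℚ.- frac y D ∣  ≡⟨ ∣frac-frac∣ x y 0<D ⟩
  frac (+ ℤ.∣ x ℤ.- y ∣) D     ≤⟨ frac-≤ 0<D (*-mono-≤ 0<e 0<D) cross ⟩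
  frac (+ W) (e * D)           ∎
  where
  open ℚ.≤-Reasoning
  cross : ℤ.∣ x ℤ.- y ∣ * (e * D) ≤ W * D
  cross = ≤-trans (≤-reflexive (trans (sym (*-assoc ℤ.∣ x ℤ.- y ∣ e D)) (cong (_* D) (*-comm ℤ.∣ x ℤ.- y ∣ e))))
                  (*-monoˡ-≤ D e∣x-y∣≤W)

frac-monoˡ-≤ : ∀ {a c b} → 0 < b → a ≤ c → frac (+ a) b ℚ.≤ frac (+ c) b
frac-monoˡ-≤ {b = b} 0<b a≤c = frac-≤ 0<b 0<b (*-monoˡ-≤ b a≤c)

frac-zero : ∀ {b} → 0 < b → frac (+ 0) b ≡ 0ℚ
frac-zero 0<b = frac-≡ {0} {0} {_} {1} 0<b (s≤s z≤n) refl

-- Counting permutations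

prepend : List ℕ → List (List ℕ) → List (List ℕ)
prepend xs ws = concatMap (λ x → map (x ∷_) ws) xs

wordsOver : List ℕ → ℕ → List (List ℕ)
wordsOver xs zero    = [ [] ]
wordsOver xs (suc l) = prepend xs (wordsOver xs l)

words≡wordsOver-upTo : ∀ a l → words a l ≡ wordsOver (upTo a) l
words≡wordsOver-upTo a zero    = refl
words≡wordsOver-upTo a (suc l) = cong (prepend (upTo a)) (words≡wordsOver-upTo a l)

module _ {p} {P : Pred ℕ p} (P? : Decidable P) where

  filter-all-map-∷ : ∀ {x} → P x → ∀ ws →
                     filter (all? P?) (map (x ∷_) ws) ≡ map (x ∷_) (filter (all? P?) ws)
  filter-all-map-∷ px [] = refl
  filter-all-map-∷ {x} px (w ∷ ws) = by (all? P? w)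
    where
    open ≡-Reasoning
    by : Dec (All P w) → filter (all? P?) (map (x ∷_) (w ∷ ws)) ≡ map (x ∷_) (filter (all? P?) (w ∷ ws))
    by (yes pw) = begin
      filter (all? P?) ((x ∷ w) ∷ map (x ∷_) ws)  ≡⟨ List.filter-accept (all? P?) (px ∷ pw) ⟩
      (x ∷ w) ∷ filter (all? P?) (map (x ∷_) ws)  ≡⟨ cong ((x ∷ w) ∷_) (filter-all-map-∷ px ws) ⟩
      map (x ∷_) (w ∷ filter (all? P?) ws)        ≡⟨ cong (map (x ∷_)) (List.filter-accept (all? P?) pw) ⟨
      map (x ∷_) (filter (all? P?) (w ∷ ws))      ∎
    by (no ¬pw) = begin
      filter (all? P?) ((x ∷ w) ∷ map (x ∷_) ws)  ≡⟨ List.filter-reject (all? P?) (¬pw ∘ All.tail) ⟩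
      filter (all? P?) (map (x ∷_) ws)            ≡⟨ filter-all-map-∷ px ws ⟩
      map (x ∷_) (filter (all? P?) ws)            ≡⟨ cong (map (x ∷_)) (List.filter-reject (all? P?) ¬pw) ⟨
      map (x ∷_) (filter (all? P?) (w ∷ ws))      ∎

  filter-all-prepend : ∀ xs ws →
                       filter (all? P?) (prepend xs ws) ≡ prepend (filter P? xs) (filter (all? P?) ws)
  filter-all-prepend []       ws = refl
  filter-all-prepend (x ∷ xs) ws with P? x
  ... | yes px = trans (List.filter-++ (all? P?) (map (x ∷_) ws) (prepend xs ws))
                       (cong₂ _++_ (filter-all-map-∷ px ws) (filter-all-prepend xs ws))
  ... | no ¬px = trans (List.filter-++ (all? P?) (map (x ∷_) ws) (prepend xs ws))
                       (cong₂ _++_ (List.filter-none (all? P?) (map⁺ (All.universal (λ _ → ¬px ∘ All.head) ws)))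
                                   (filter-all-prepend xs ws))

  filter-all-wordsOver : ∀ xs l → filter (all? P?) (wordsOver xs l) ≡ wordsOver (filter P? xs) l
  filter-all-wordsOver xs zero    = refl
  filter-all-wordsOver xs (suc l) =
    trans (filter-all-prepend xs (wordsOver xs l)) (cong (prepend (filter P? xs)) (filter-all-wordsOver xs l))

_≢?_ : (x y : ℕ) → Dec (x ≢ y)
x ≢? y = ¬? (x ≟ y)

filter-unique-map-∷ : ∀ x ws →
  filter unique? (map (x ∷_) ws) ≡ map (x ∷_) (filter unique? (filter (all? (x ≢?_)) ws))
filter-unique-map-∷ x []       = refl
filter-unique-map-∷ x (w ∷ ws) = by (all? (x ≢?_) w) (unique? w)
  where
  open ≡-Reasoning
  by : Dec (All (x ≢_) w) → Dec (Unique w) →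
       filter unique? (map (x ∷_) (w ∷ ws)) ≡ map (x ∷_) (filter unique? (filter (all? (x ≢?_)) (w ∷ ws)))
  by (yes x∉w) (yes uw) = begin
    filter unique? ((x ∷ w) ∷ map (x ∷_) ws)
      ≡⟨ List.filter-accept unique? (x∉w ∷ uw) ⟩
    (x ∷ w) ∷ filter unique? (map (x ∷_) ws)
      ≡⟨ cong ((x ∷ w) ∷_) (filter-unique-map-∷ x ws) ⟩
    map (x ∷_) (w ∷ filter unique? (filter (all? (x ≢?_)) ws))
      ≡⟨ cong (map (x ∷_)) (List.filter-accept unique? uw) ⟨
    map (x ∷_) (filter unique? (w ∷ filter (all? (x ≢?_)) ws))
      ≡⟨ cong (map (x ∷_) ∘ filter unique?) (List.filter-accept (all? (x ≢?_)) x∉w) ⟨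
    map (x ∷_) (filter unique? (filter (all? (x ≢?_)) (w ∷ ws))) ∎
  by (yes x∉w) (no ¬uw) = begin
    filter unique? ((x ∷ w) ∷ map (x ∷_) ws)
      ≡⟨ List.filter-reject unique? {x ∷ w} (λ { (_ ∷ uw) → ¬uw uw }) ⟩
    filter unique? (map (x ∷_) ws)
      ≡⟨ filter-unique-map-∷ x ws ⟩
    map (x ∷_) (filter unique? (filter (all? (x ≢?_)) ws))
      ≡⟨ cong (map (x ∷_)) (List.filter-reject unique? ¬uw) ⟨
    map (x ∷_) (filter unique? (w ∷ filter (all? (x ≢?_)) ws))
      ≡⟨ cong (map (x ∷_) ∘ filter unique?) (List.filter-accept (all? (x ≢?_)) x∉w) ⟨
    map (x ∷_) (filter unique? (filter (all? (x ≢?_)) (w ∷ ws))) ∎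
  by (no x∈w) _ = begin
    filter unique? ((x ∷ w) ∷ map (x ∷_) ws)
      ≡⟨ List.filter-reject unique? {x ∷ w} (λ { (x∉w ∷ _) → x∈w x∉w }) ⟩
    filter unique? (map (x ∷_) ws)
      ≡⟨ filter-unique-map-∷ x ws ⟩
    map (x ∷_) (filter unique? (filter (all? (x ≢?_)) ws))
      ≡⟨ cong (map (x ∷_) ∘ filter unique?) (List.filter-reject (all? (x ≢?_)) x∈w) ⟨
    map (x ∷_) (filter unique? (filter (all? (x ≢?_)) (w ∷ ws))) ∎

!-mono-≤ : ∀ {m n} → m ≤ n → m ! ≤ n !
!-mono-≤ {n = n} z≤n       = 1≤n! n
!-mono-≤ (s≤s m≤n) = *-mono-≤ (s≤s m≤n) (!-mono-≤ m≤n)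

n*[n∸1]!≤n! : ∀ n → n * (n ∸ 1) ! ≤ n !
n*[n∸1]!≤n! zero    = z≤n
n*[n∸1]!≤n! (suc n) = ≤-refl

length-filter-≢ : ∀ {x xs} → x ∈ xs → length (filter (x ≢?_) xs) ≤ length xs ∸ 1
length-filter-≢ {x} {xs} x∈xs =
  ∸-monoˡ-≤ 1 (List.filter-notAll (x ≢?_) xs (Any.map (λ x≡y x≢y → x≢y x≡y) x∈xs))

length-uniqueWords≤! : ∀ xs l → length (filter unique? (wordsOver xs l)) ≤ length xs !
length-uniqueWords≤! xs zero    = 1≤n! (length xs)
length-uniqueWords≤! xs (suc l) = ≤-trans (prefixes xs (All.tabulate id)) (n*[n∸1]!≤n! (length xs))
  where
  open ≤-Reasoning
  W = wordsOver xs l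
  m = length xs ∸ 1
  prefix : ∀ {x} → x ∈ xs → length (filter unique? (map (x ∷_) W)) ≤ m !
  prefix {x} x∈xs = begin
    length (filter unique? (map (x ∷_) W))
      ≡⟨ cong length (filter-unique-map-∷ x W) ⟩
    length (map (x ∷_) (filter unique? (filter (all? (x ≢?_)) W)))
      ≡⟨ List.length-map (x ∷_) (filter unique? (filter (all? (x ≢?_)) W)) ⟩
    length (filter unique? (filter (all? (x ≢?_)) W))
      ≡⟨ cong (length ∘ filter unique?) (filter-all-wordsOver (x ≢?_) xs l) ⟩
    length (filter unique? (wordsOver (filter (x ≢?_) xs) l))
      ≤⟨ length-uniqueWords≤! (filter (x ≢?_) xs) l ⟩
    length (filter (x ≢?_) xs) !
      ≤⟨ !-mono-≤ (length-filter-≢ x∈xs) ⟩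
    m ! ∎
  prefixes : ∀ ys → All (_∈ xs) ys → length (filter unique? (prepend ys W)) ≤ length ys * m !
  prefixes []       []                = z≤n
  prefixes (y ∷ ys) (y∈xs ∷ ys⊆xs) = begin
    length (filter unique? (map (y ∷_) W ++ prepend ys W))
      ≡⟨ cong length (List.filter-++ unique? (map (y ∷_) W) (prepend ys W)) ⟩
    length (filter unique? (map (y ∷_) W) ++ filter unique? (prepend ys W))
      ≡⟨ List.length-++ (filter unique? (map (y ∷_) W)) ⟩
    length (filter unique? (map (y ∷_) W)) + length (filter unique? (prepend ys W))
      ≤⟨ +-mono-≤ (prefix y∈xs) (prefixes ys ys⊆xs) ⟩
    m ! + length ys * m ! ∎

length-Sn≤n! : ∀ n → length (Sn n) ≤ n !
length-Sn≤n! n = begin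
  length (filter unique? (words n n))          ≡⟨ cong (length ∘ filter unique?) (words≡wordsOver-upTo n n) ⟩
  length (filter unique? (wordsOver (upTo n) n)) ≤⟨ length-uniqueWords≤! (upTo n) n ⟩
  length (upTo n) !                              ≡⟨ cong _! (List.length-upTo n) ⟩
  n !                                            ∎
  where open ≤-Reasoning

-- Binomial coefficients

pascal : ∀ n k → suc n C suc k ≡ n C k + n C suc k
pascal n k = sym (nCk+nC[k+1]≡[n+1]C[k+1] n k)

C-sym : ∀ a b → (a + b) C a ≡ (a + b) C b
C-sym a b = trans (nCk≡nC[n∸k] (m≤m+n a b)) (cong ((a + b) C_) (m+n∸m≡n a b))

C≤1 : ∀ {m j} → m ≤ j → m C j ≤ 1
C≤1 {m} m≤j with m≤n⇒m<n∨m≡n m≤j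
... | inj₁ m<j = ≤-trans (≤-reflexive (k>n⇒nCk≡0 m<j)) z≤n
... | inj₂ refl = ≤-reflexive (nCn≡1 m)

C≤2^ : ∀ m j → m C j ≤ 2 ^ m
C≤2^ m       zero    = m^n>0 2 m
C≤2^ zero    (suc j) = z≤n
C≤2^ (suc m) (suc j) = begin
  suc m C suc j          ≡⟨ pascal m j ⟩
  m C j + m C suc j      ≤⟨ +-mono-≤ (C≤2^ m j) (C≤2^ m (suc j)) ⟩
  2 ^ m + 2 ^ m          ≡⟨ cong (_+_ (2 ^ m)) (+-identityʳ (2 ^ m)) ⟨
  2 ^ suc m              ∎
  where open ≤-Reasoning

C-monoˡ-≤ : ∀ j {m n} → m ≤ n → m C j ≤ n C j
C-monoˡ-≤ j {m} {n} m≤n with m≤n⇒m<n∨m≡n m≤n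
... | inj₂ refl = ≤-refl
C-monoˡ-≤ j {m} {suc n} _ | inj₁ (s≤s m≤n) = ≤-trans (C-monoˡ-≤ j m≤n) (step j)
  where
  step : ∀ j → n C j ≤ suc n C j
  step zero    = ≤-refl
  step (suc j) = ≤-trans (m≤n+m (n C suc j) (n C j)) (≤-reflexive (sym (pascal n j)))

C-absorption : ∀ m j → suc j * (suc m C suc j) ≡ suc m * (m C j)
C-absorption zero    zero    = refl
C-absorption zero    (suc j) = *-zeroʳ (suc (suc j))
C-absorption (suc m) zero    = trans (*-identityˡ _) (trans (nC1≡n (suc (suc m))) (sym (*-identityʳ _)))
C-absorption (suc m) (suc j) = begin
  suc (suc j) * (suc (suc m) C suc (suc j))
    ≡⟨ cong (suc (suc j) *_) (pascal (suc m) (suc j)) ⟩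
  suc (suc j) * (P + Q)
    ≡⟨ rearrange₁ (suc j) P Q ⟩
  suc j * P + P + suc (suc j) * Q
    ≡⟨ cong₂ (λ a b → a + P + b) (C-absorption m j) (C-absorption m (suc j)) ⟩
  suc m * (m C j) + P + suc m * (m C suc j)
    ≡⟨ rearrange₂ (suc m) (m C j) P (m C suc j) ⟩
  suc m * (m C j + m C suc j) + P
    ≡⟨ cong (λ c → suc m * c + P) (pascal m j) ⟨
  suc m * P + P
    ≡⟨ +-comm (suc m * P) P ⟩
  suc (suc m) * P ∎
  where
  open ≡-Reasoning
  P = suc m C suc j
  Q = suc m C suc (suc j)
  rearrange₁ : ∀ a P Q → suc a * (P + Q) ≡ a * P + P + suc a * Q
  rearrange₁ = solve-∀
  rearrange₂ : ∀ a x P y → a * x + P + a * y ≡ a * (x + y) + P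
  rearrange₂ = solve-∀

C-ratio : ∀ b K → ((b + suc K) C b) * suc K ≡ ((b + K) C b) * suc (b + K)
C-ratio b K = begin
  ((b + suc K) C b) * suc K        ≡⟨ cong (_* suc K) (C-sym b (suc K)) ⟩
  ((b + suc K) C suc K) * suc K    ≡⟨ cong (λ t → (t C suc K) * suc K) (+-suc b K) ⟩
  (suc (b + K) C suc K) * suc K    ≡⟨ *-comm _ (suc K) ⟩
  suc K * (suc (b + K) C suc K)    ≡⟨ C-absorption (b + K) K ⟩
  suc (b + K) * ((b + K) C K)      ≡⟨ cong (suc (b + K) *_) (C-sym b K) ⟨
  suc (b + K) * ((b + K) C b)      ≡⟨ *-comm (suc (b + K)) _ ⟩
  ((b + K) C b) * suc (b + K)      ∎
  where open ≡-Reasoning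

bernoulli : ∀ K b → K ^ b * (K + suc b) ≤ suc K ^ suc b
bernoulli K zero    = ≤-reflexive (base K)
  where
  base : ∀ K → 1 * (K + 1) ≡ suc K * 1
  base = solve-∀
bernoulli K (suc b) = begin
  K * K ^ b * (K + suc (suc b))        ≡⟨ expand K (K ^ b) b ⟩
  K * (K ^ b * (K + suc b)) + K * K ^ b ≤⟨ +-mono-≤ (*-monoʳ-≤ K (bernoulli K b)) (^-monoˡ-≤ (suc b) (n≤1+n K)) ⟩
  K * suc K ^ suc b + suc K ^ suc b     ≡⟨ +-comm (K * suc K ^ suc b) _ ⟩
  suc K ^ suc (suc b)                   ∎
  where
  open ≤-Reasoning
  expand : ∀ K x b → K * x * (K + suc (suc b)) ≡ K * (x * (K + suc b)) + K * x
  expand = solve-∀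

oddBinomial : ℕ → ℕ
oddBinomial b = (b + suc b) C b

-- binom(b+K, b)/K^b decreases for K ≥ b + 1: consecutive ratios are
-- (b+K+1)/(K+1) ≤ ((K+1)/K)^b, by the Bernoulli inequality.
C-growth : ∀ b {K} → suc b ≤ K → ((b + K) C b) * suc b ^ b ≤ K ^ b * oddBinomial b
C-growth b {m} b<m = subst (λ K → ((b + K) C b) * suc b ^ b ≤ K ^ b * oddBinomial b)
                           (m+[n∸m]≡n b<m) (shifted b (m ∸ suc b))
  where
  shifted : ∀ b j → ((b + (suc b + j)) C b) * suc b ^ b ≤ (suc b + j) ^ b * oddBinomial b
  shifted b zero    rewrite +-identityʳ b = ≤-reflexive (*-comm (oddBinomial b) (suc b ^ b))
  shifted b (suc j) rewrite +-suc (suc b) j = *-cancelʳ-≤ _ _ (suc K) (begin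
    X (suc K) * u * suc K              ≡⟨ swap (X (suc K)) u (suc K) ⟩
    X (suc K) * suc K * u              ≡⟨ cong (_* u) (C-ratio b K) ⟩
    X K * suc (b + K) * u              ≡⟨ swap (X K) (suc (b + K)) u ⟩
    X K * u * suc (b + K)              ≤⟨ *-monoˡ-≤ (suc (b + K)) (shifted b j) ⟩
    K ^ b * Y * suc (b + K)            ≡⟨ swap (K ^ b) Y (suc (b + K)) ⟩
    K ^ b * suc (b + K) * Y            ≡⟨ cong (λ t → K ^ b * t * Y) (trans (cong suc (+-comm b K)) (sym (+-suc K b))) ⟩
    K ^ b * (K + suc b) * Y            ≤⟨ *-monoˡ-≤ Y (bernoulli K b) ⟩
    suc K ^ suc b * Y                  ≡⟨ rotate (suc K) (suc K ^ b) Y ⟩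
    suc K ^ b * Y * suc K              ∎)
    where
    open ≤-Reasoning
    K = suc b + j
    X = λ K → (b + K) C b
    Y = oddBinomial b
    u = suc b ^ b
    swap : ∀ x y z → x * y * z ≡ x * z * y
    swap = solve-∀
    rotate : ∀ a x y → a * x * y ≡ x * y * a
    rotate = solve-∀

C-scaled : ∀ {u K r k} → suc u * r ≤ k → K * r ≤ k →
           (suc u * r) ^ u * ((u + K) C u) ≤ k ^ u * oddBinomial u
C-scaled {u} {K} {r} {k} [1+u]r≤k Kr≤k = begin
  (suc u * r) ^ u * ((u + K) C u)       ≤⟨ *-monoʳ-≤ ((suc u * r) ^ u) (C-monoˡ-≤ u (+-monoʳ-≤ u (m≤m⊔n K (suc u)))) ⟩
  (suc u * r) ^ u * ((u + K′) C u)      ≡⟨ cong (_* ((u + K′) C u)) (*-^-distrib (suc u) r u) ⟩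
  suc u ^ u * r ^ u * ((u + K′) C u)    ≡⟨ rotate (suc u ^ u) (r ^ u) ((u + K′) C u) ⟩
  ((u + K′) C u) * suc u ^ u * r ^ u    ≤⟨ *-monoˡ-≤ (r ^ u) (C-growth u (m≤n⊔m K (suc u))) ⟩
  K′ ^ u * oddBinomial u * r ^ u        ≡⟨ swap (K′ ^ u) (oddBinomial u) (r ^ u) ⟩
  K′ ^ u * r ^ u * oddBinomial u        ≡⟨ cong (_* oddBinomial u) (*-^-distrib K′ r u) ⟨
  (K′ * r) ^ u * oddBinomial u          ≤⟨ *-monoˡ-≤ (oddBinomial u) (^-monoˡ-≤ u K′r≤k) ⟩
  k ^ u * oddBinomial u                 ∎
  where
  open ≤-Reasoning
  K′ = K ⊔ suc u
  K′r≤k : K′ * r ≤ k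
  K′r≤k = ≤-trans (≤-reflexive (*-distribʳ-⊔ r K (suc u))) (⊔-lub Kr≤k [1+u]r≤k)
  rotate : ∀ a b c → a * b * c ≡ c * a * b
  rotate = solve-∀
  swap : ∀ a b c → a * b * c ≡ a * c * b
  swap = solve-∀

-- Ramanujan sums

length-oneTo : ∀ r → length (oneTo r) ≡ r
length-oneTo r = trans (List.length-map suc (upTo r)) (List.length-upTo r)

oneTo-suc : ∀ r → oneTo (suc r) ≡ oneTo r ∷ʳ suc r
oneTo-suc r = trans (cong (map suc) (sym (List.upTo-∷ʳ r))) (List.map-++ suc (upTo r) (r ∷ []))

sum-2^-oneTo : ∀ r → sum (map (2 ^_) (oneTo r)) + 2 ≡ 2 ^ suc r
sum-2^-oneTo zero    = refl
sum-2^-oneTo (suc r) = begin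
  sum (map (2 ^_) (oneTo (suc r))) + 2
    ≡⟨ cong (λ ds → sum (map (2 ^_) ds) + 2) (oneTo-suc r) ⟩
  sum (map (2 ^_) (oneTo r ∷ʳ suc r)) + 2
    ≡⟨ cong (λ ns → sum ns + 2) (List.map-++ (2 ^_) (oneTo r) (suc r ∷ [])) ⟩
  sum (map (2 ^_) (oneTo r) ∷ʳ 2 ^ suc r) + 2
    ≡⟨ cong (_+ 2) (sum-++ (map (2 ^_) (oneTo r)) (2 ^ suc r ∷ [])) ⟩
  sum (map (2 ^_) (oneTo r)) + (2 ^ suc r + 0) + 2
    ≡⟨ shuffle (sum (map (2 ^_) (oneTo r))) (2 ^ suc r) ⟩
  (sum (map (2 ^_) (oneTo r)) + 2) + 2 ^ suc r
    ≡⟨ cong (_+ 2 ^ suc r) (sum-2^-oneTo r) ⟩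
  2 ^ suc r + 2 ^ suc r
    ≡⟨ cong (_+_ (2 ^ suc r)) (+-identityʳ (2 ^ suc r)) ⟨
  2 ^ suc (suc r) ∎
  where
  open ≡-Reasoning
  shuffle : ∀ a b → a + (b + 0) + 2 ≡ (a + 2) + b
  shuffle = solve-∀

∣ramanujanF∣<2^ : ∀ fuel r z → ℤ.∣ ramanujanF fuel r z ∣ < 2 ^ r
∣ramanujanF∣<2^ zero       r       z = m^n>0 2 r
∣ramanujanF∣<2^ (suc fuel) zero    z = ≤-refl
∣ramanujanF∣<2^ (suc fuel) (suc r) z = begin-strict
  ℤ.∣ a ℤ.- s ∣                  ≤⟨ ℤ.∣i-j∣≤∣i∣+∣j∣ a s ⟩
  ℤ.∣ a ∣ + ℤ.∣ s ∣              ≤⟨ +-mono-≤ ∣a∣≤1+r (∣sumℤ∣≤sum∣∣ g (oneTo r)) ⟩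
  suc r + Σ∣g∣                   <⟨ n<1+n (suc r + Σ∣g∣) ⟩
  suc (suc r + Σ∣g∣)             ≡⟨ shuffle r Σ∣g∣ ⟩
  Σ∣g∣ + r + 2                   ≡⟨ cong (λ l → Σ∣g∣ + l + 2) (length-oneTo r) ⟨
  Σ∣g∣ + length (oneTo r) + 2    ≤⟨ +-monoˡ-≤ 2 (sum-<-+length ∣g∣<2^ (oneTo r)) ⟩
  sum (map (2 ^_) (oneTo r)) + 2 ≡⟨ sum-2^-oneTo r ⟩
  2 ^ suc r                      ∎
  where
  open ≤-Reasoning
  a = if (z ℤ.%ℕ suc r) ≡ᵇ 0 then + suc r else + 0
  g = λ d → if does (d ∣? suc r) then ramanujanF fuel d z else + 0
  s = sumℤ (map g (oneTo r))
  Σ∣g∣ = sum (map (ℤ.∣_∣ ∘ g) (oneTo r))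
  ∣a∣≤1+r : ℤ.∣ a ∣ ≤ suc r
  ∣a∣≤1+r with (z ℤ.%ℕ suc r) ≡ᵇ 0
  ... | true  = ≤-refl
  ... | false = z≤n
  ∣g∣<2^ : ∀ d → ℤ.∣ g d ∣ < 2 ^ d
  ∣g∣<2^ d with does (d ∣? suc r)
  ... | true  = ∣ramanujanF∣<2^ fuel d z
  ... | false = m^n>0 2 d
  shuffle : ∀ r S → suc (suc r + S) ≡ S + r + 2
  shuffle = solve-∀

ramanujan-1 : ∀ z → ramanujan 1 z ≡ + 1
ramanujan-1 z with z ℤ.%ℕ 1 | n%ℕd<d z 1
... | zero  | _ = refl
... | suc _ | s≤s ()

-- Comparison of the two measures

-- For 2 ≤ r ∣ n the r-th summand of A_{k,n} is a polynomial in k of degree n/r − 1 ≤ ⌊n/2⌋ − 1.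
correctionDegree : ℕ → ℕ
correctionDegree n = n / 2 ∸ 1

≤correctionDegree : ∀ {u r n} → 2 ≤ r → suc u * r ≡ n → u ≤ correctionDegree n
≤correctionDegree {u} {r} {n} 2≤r n≡ = ∸-monoˡ-≤ 1 (begin
  suc u            ≡⟨ m*n/n≡m (suc u) 2 ⟨
  suc u * 2 / 2    ≤⟨ /-monoˡ-≤ 2 (*-monoʳ-≤ (suc u) 2≤r) ⟩
  suc u * r / 2    ≡⟨ cong (_/ 2) n≡ ⟩
  n / 2            ∎)
  where open ≤-Reasoning

C-degree-bound : ∀ {n k u K r} → 2 ≤ r → suc u * r ≡ n → K * r ≤ k → n ≤ k →
                 n ^ correctionDegree n * ((u + K) C u) ≤ k ^ correctionDegree n * oddBinomial u
C-degree-bound {n} {k} {u} {K} {r} 2≤r n≡ Kr≤k n≤k = begin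
  n ^ d * ((u + K) C u)                 ≡⟨ cong (_* ((u + K) C u)) (^-split n {u} u≤d) ⟩
  n ^ (d ∸ u) * n ^ u * ((u + K) C u)   ≡⟨ *-assoc (n ^ (d ∸ u)) _ _ ⟩
  n ^ (d ∸ u) * (n ^ u * ((u + K) C u)) ≤⟨ *-mono-≤ (^-monoˡ-≤ (d ∸ u) n≤k) scaled ⟩
  k ^ (d ∸ u) * (k ^ u * oddBinomial u) ≡⟨ *-assoc (k ^ (d ∸ u)) _ _ ⟨
  k ^ (d ∸ u) * k ^ u * oddBinomial u   ≡⟨ cong (_* oddBinomial u) (^-split k {u} u≤d) ⟨
  k ^ d * oddBinomial u                 ∎
  where
  open ≤-Reasoning
  d = correctionDegree n
  u≤d : u ≤ d
  u≤d = ≤correctionDegree 2≤r n≡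
  scaled : n ^ u * ((u + K) C u) ≤ k ^ u * oddBinomial u
  scaled = subst (λ m → m ^ u * ((u + K) C u) ≤ k ^ u * oddBinomial u) n≡
                 (C-scaled {u} {K} {r} (subst (_≤ k) (sym n≡) n≤k) Kr≤k)

termBound : ℕ → ℕ → ℕ
termBound n zero    = 0
termBound n (suc r) = if does (suc r ∣? n) then (2 ^ suc r ∸ 1) * oddBinomial (n / suc r ∸ 1) else 0

affineTerm-bound : ∀ {n k} π {r} → 1 ≤ n → n ≤ k → 2 ≤ r →
  n ^ correctionDegree n * ℤ.∣ affineTerm k n π r ∣ ≤ k ^ correctionDegree n * termBound n r
affineTerm-bound {n} {k} π {suc r} 1≤n n≤k 2≤r =
  if-does-∧ (λ t → n ^ d * ℤ.∣ t ∣ ≤ k ^ d * termBound n R) (R ∣? n) (R ∣? (k ∸ c))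
            divisorCase (λ _ → ≤-trans (≤-reflexive (*-zeroʳ (n ^ d))) z≤n)
  where
  R = suc r
  c = cdes π
  d = correctionDegree n
  ram = ramanujan R (ℤ.- + maj π)
  divisorCase : R ∣ n → R ∣ k ∸ c →
                n ^ d * ℤ.∣ + ((n + (k ∸ c) ∸ R) / R C (n ∸ R) / R) ℤ.* ram ∣ ≤ k ^ d * termBound n R
  divisorCase (divides zero n≡0) _ = ⊥-elim (<⇒≢ 1≤n (sym n≡0))
  divisorCase R∣n@(divides (suc u) n≡) (divides K k∸c≡) = begin
    n ^ d * ℤ.∣ + ((n + (k ∸ c) ∸ R) / R C (n ∸ R) / R) ℤ.* ram ∣
      ≡⟨ cong (n ^ d *_) (ℤ.abs-* (+ ((n + (k ∸ c) ∸ R) / R C (n ∸ R) / R)) ram) ⟩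
    n ^ d * (((n + (k ∸ c) ∸ R) / R C (n ∸ R) / R) * ℤ.∣ ram ∣)
      ≡⟨ cong₂ (λ a b → n ^ d * ((a C b) * ℤ.∣ ram ∣)) top bottom ⟩
    n ^ d * (((u + K) C u) * ℤ.∣ ram ∣)
      ≡⟨ *-assoc (n ^ d) _ _ ⟨
    n ^ d * ((u + K) C u) * ℤ.∣ ram ∣
      ≤⟨ *-mono-≤ (C-degree-bound {u = u} {K} 2≤r (sym n≡) KR≤k n≤k)
                  (∸-monoˡ-≤ 1 (∣ramanujanF∣<2^ R R (ℤ.- + maj π))) ⟩
    k ^ d * oddBinomial u * (2 ^ R ∸ 1)
      ≡⟨ cong (λ v → k ^ d * oddBinomial v * (2 ^ R ∸ 1)) quotient ⟨
    k ^ d * oddBinomial (n / R ∸ 1) * (2 ^ R ∸ 1)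
      ≡⟨ rotate (k ^ d) (oddBinomial (n / R ∸ 1)) (2 ^ R ∸ 1) ⟩
    k ^ d * ((2 ^ R ∸ 1) * oddBinomial (n / R ∸ 1))
      ≡⟨ cong (k ^ d *_) (if-does-yes (R ∣? n) R∣n) ⟨
    k ^ d * termBound n R ∎
    where
    open ≤-Reasoning
    KR≤k : K * R ≤ k
    KR≤k = ≤-trans (≤-reflexive (sym k∸c≡)) (m∸n≤m k c)
    top : (n + (k ∸ c) ∸ R) / R ≡ u + K
    top = begin-equality
      (n + (k ∸ c) ∸ R) / R                ≡⟨ cong₂ (λ a b → (a + b ∸ R) / R) n≡ k∸c≡ ⟩
      (R + u * R + K * R ∸ R) / R          ≡⟨ cong (λ a → (a ∸ R) / R) (+-assoc R (u * R) (K * R)) ⟩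
      (R + (u * R + K * R) ∸ R) / R        ≡⟨ cong (_/ R) (m+n∸m≡n R (u * R + K * R)) ⟩
      (u * R + K * R) / R                  ≡⟨ cong (_/ R) (*-distribʳ-+ R u K) ⟨
      (u + K) * R / R                      ≡⟨ m*n/n≡m (u + K) R ⟩
      u + K                                ∎
    bottom : (n ∸ R) / R ≡ u
    bottom = trans (cong (λ a → (a ∸ R) / R) n≡) (trans (cong (_/ R) (m+n∸m≡n R (u * R))) (m*n/n≡m u R))
    quotient : n / R ∸ 1 ≡ u
    quotient = cong (_∸ 1) (trans (cong (_/ R) n≡) (m*n/n≡m (suc u) R))
    rotate : ∀ a b c → a * b * c ≡ a * (c * b)
    rotate = solve-∀

normaliser : ℕ → ℕ → ℕ
normaliser n k = n * k ^ (n ∸ 1)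

normaliser-pos : ∀ {n k} → 1 ≤ n → 1 ≤ k → 0 < normaliser n k
normaliser-pos {n} {k} 1≤n 1≤k = *-mono-≤ 1≤n (m^n>0 k {{>-nonZero 1≤k}} (n ∸ 1))

0<nᵈ*normaliser : ∀ {n k} → 1 ≤ n → n ≤ k → 0 < n ^ correctionDegree n * normaliser n k
0<nᵈ*normaliser {n} 1≤n n≤k =
  *-mono-≤ (m^n>0 n {{>-nonZero 1≤n}} (correctionDegree n)) (normaliser-pos 1≤n (≤-trans 1≤n n≤k))

All-drop-1-oneTo : ∀ {p} {P : ℕ → Set p} n → (∀ {r} → 2 ≤ r → P r) → All P (drop 1 (oneTo n))
All-drop-1-oneTo zero    _   = []
All-drop-1-oneTo (suc m) P≥2 = map⁺ (applyUpTo⁺₂ suc m (λ _ → P≥2 (s≤s (s≤s z≤n))))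

correctionBound : ℕ → ℕ
correctionBound n = sum (map (termBound n) (drop 1 (oneTo n)))

affineTerm-1 : ∀ {n k} π → cdes π ≤ k → affineTerm k n π 1 ≡ + ((n + k ∸ cdes π ∸ 1) C (n ∸ 1))
affineTerm-1 {n} {k} π c≤k =
  if-does-∧ (_≡ + ((n + k ∸ c ∸ 1) C (n ∸ 1))) (1 ∣? n) (1 ∣? (k ∸ c)) (λ _ _ → begin
    + ((n + (k ∸ c) ∸ 1) / 1 C (n ∸ 1) / 1) ℤ.* ramanujan 1 (ℤ.- + maj π)
      ≡⟨ cong (+ ((n + (k ∸ c) ∸ 1) / 1 C (n ∸ 1) / 1) ℤ.*_) (ramanujan-1 (ℤ.- + maj π)) ⟩
    + ((n + (k ∸ c) ∸ 1) / 1 C (n ∸ 1) / 1) ℤ.* + 1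
      ≡⟨ ℤ.*-identityʳ _ ⟩
    + ((n + (k ∸ c) ∸ 1) / 1 C (n ∸ 1) / 1)
      ≡⟨ cong₂ (λ a b → + (a C b)) (n/1≡n (n + (k ∸ c) ∸ 1)) (n/1≡n (n ∸ 1)) ⟩
    + ((n + (k ∸ c) ∸ 1) C (n ∸ 1))
      ≡⟨ cong (λ a → + ((a ∸ 1) C (n ∸ 1))) (+-∸-assoc n c≤k) ⟨
    + ((n + k ∸ c ∸ 1) C (n ∸ 1)) ∎)
    (λ ¬1∣ → ⊥-elim (¬1∣ (1∣ n , 1∣ (k ∸ c))))
  where
  open ≡-Reasoning
  c = cdes π

affine-cut-below : ∀ {n k} π → 1 ≤ n → n ≤ k → cdes π < k →
  ℚ.∣ affineShuffle k n π ℚ.- cutShuffle k n π ∣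
    ℚ.≤ frac (+ (k ^ correctionDegree n * correctionBound n)) (n ^ correctionDegree n * normaliser n k)
affine-cut-below {suc m} {k} π 1≤n n≤k c<k with cdes π <ᵇ k | <ᵇ-reflects-< (cdes π) k
... | false | ofⁿ c≮k = ⊥-elim (c≮k c<k)
... | true  | ofʸ _   = ∣frac-frac∣≤ (t₁ ℤ.+ rest) cut (normaliser-pos 1≤n (≤-trans 1≤n n≤k)) (m^n>0 n d) (begin
  n ^ d * ℤ.∣ (t₁ ℤ.+ rest) ℤ.- cut ∣  ≡⟨ cong (λ t → n ^ d * ℤ.∣ (t ℤ.+ rest) ℤ.- cut ∣) t₁≡cut ⟩
  n ^ d * ℤ.∣ (cut ℤ.+ rest) ℤ.- cut ∣ ≡⟨ cong (λ t → n ^ d * ℤ.∣ t ∣) (cancel cut rest) ⟩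
  n ^ d * ℤ.∣ rest ∣                   ≤⟨ ∣sumℤ∣-weighted {c = n ^ d} {k ^ d} (drop 1 (oneTo n)) termBounds ⟩
  k ^ d * correctionBound n            ∎)
  where
  open ≤-Reasoning
  n = suc m
  d = correctionDegree n
  t₁ = affineTerm k n π 1
  rest = sumℤ (map (affineTerm k n π) (drop 1 (oneTo n)))
  cut = + ((n + k ∸ cdes π ∸ 1) C (n ∸ 1))
  t₁≡cut : t₁ ≡ cut
  t₁≡cut = affineTerm-1 {n} π (<⇒≤ c<k)
  termBounds : All (λ r → n ^ d * ℤ.∣ affineTerm k n π r ∣ ≤ k ^ d * termBound n r) (drop 1 (oneTo n))
  termBounds = All-drop-1-oneTo n (affineTerm-bound π 1≤n n≤k)
  cancel : ∀ a b → (a ℤ.+ b) ℤ.- a ≡ b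
  cancel = ℤSolver.solve-∀

affine-cut-above : ∀ {n k} π → 1 ≤ n → n ≤ k → k ≤ cdes π →
  ℚ.∣ affineShuffle k n π ℚ.- cutShuffle k n π ∣
    ℚ.≤ frac (+ (k ^ correctionDegree n * n)) (n ^ correctionDegree n * normaliser n k)
affine-cut-above {n} {k} π 1≤n n≤k k≤c with cdes π <ᵇ k | <ᵇ-reflects-< (cdes π) k
... | true  | ofʸ c<k = ⊥-elim (<⇒≱ c<k k≤c)
... | false | ofⁿ _   = indicator ((k ≡ᵇ cdes π) ∧ ((maj π % suc (n ∸ 1)) ≡ᵇ 0))
  where
  d = correctionDegree n
  D = normaliser n k
  0<D = normaliser-pos 1≤n (≤-trans 1≤n n≤k)
  y = (n + k ∸ cdes π ∸ 1) C (n ∸ 1)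
  Bound = frac (+ (k ^ d * n)) (n ^ d * D)
  y≤1 : y ≤ 1
  y≤1 = C≤1 (∸-monoˡ-≤ 1 (≤-trans (∸-monoʳ-≤ (n + k) k≤c) (≤-reflexive (m+n∸n≡m n k))))
  numerator≤n : ∀ a → a ≤ n → ℚ.∣ frac (+ a) D ℚ.- frac (+ y) D ∣ ℚ.≤ Bound
  numerator≤n a a≤n = ∣frac-frac∣≤ (+ a) (+ y) 0<D (m^n>0 n {{>-nonZero 1≤n}} d) (*-mono-≤ (^-monoˡ-≤ d n≤k) (begin
    ℤ.∣ + a ℤ.- + y ∣  ≡⟨ cong ℤ.∣_∣ (ℤ.m-n≡m⊖n a y) ⟩
    ℤ.∣ a ℤ.⊖ y ∣      ≤⟨ ℤ.∣m⊝n∣≤m⊔n a y ⟩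
    a ⊔ y              ≤⟨ ⊔-lub a≤n (≤-trans y≤1 1≤n) ⟩
    n                  ∎))
    where open ≤-Reasoning
  indicator : ∀ b → ℚ.∣ (if b then frac (+ 1) (k ^ (n ∸ 1)) else 0ℚ) ℚ.- frac (+ y) D ∣ ℚ.≤ Bound
  indicator true  = subst (λ q → ℚ.∣ q ℚ.- frac (+ y) D ∣ ℚ.≤ Bound)
                          (frac-≡ 0<D (m^n>0 k {{>-nonZero (≤-trans 1≤n n≤k)}} (n ∸ 1)) (sym (*-identityˡ D)))
                          (numerator≤n n ≤-refl)
  indicator false = subst (λ q → ℚ.∣ q ℚ.- frac (+ y) D ∣ ℚ.≤ Bound) (frac-zero 0<D) (numerator≤n 0 z≤n)

discrepancyBound : ℕ → ℕ
discrepancyBound n = n ⊔ correctionBound n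

∣affine-cut∣≤ : ∀ {n k} π → 1 ≤ n → n ≤ k →
  ℚ.∣ affineShuffle k n π ℚ.- cutShuffle k n π ∣
    ℚ.≤ frac (+ (k ^ correctionDegree n * discrepancyBound n)) (n ^ correctionDegree n * normaliser n k)
∣affine-cut∣≤ {n} {k} π 1≤n n≤k with cdes π <? k
... | yes c<k = ℚ.≤-trans (affine-cut-below π 1≤n n≤k c<k)
  (frac-monoˡ-≤ (0<nᵈ*normaliser 1≤n n≤k) (*-monoʳ-≤ (k ^ correctionDegree n) (m≤n⊔m n (correctionBound n))))
... | no c≮k  = ℚ.≤-trans (affine-cut-above π 1≤n n≤k (≮⇒≥ c≮k))
  (frac-monoˡ-≤ (0<nᵈ*normaliser 1≤n n≤k) (*-monoʳ-≤ (k ^ correctionDegree n) (m≤m⊔n n (correctionBound n))))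

sumℚ-≤ : ∀ {f : List ℕ → ℚ} {W b} → 0 < b → ∀ πs → All (λ π → f π ℚ.≤ frac (+ W) b) πs →
         sumℚ (map f πs) ℚ.≤ frac (+ (length πs * W)) b
sumℚ-≤ 0<b []       []        = ℚ.≤-reflexive (sym (frac-zero 0<b))
sumℚ-≤ {f} {W} {b} 0<b (π ∷ πs) (fπ≤ ∷ fπs≤) = begin
  f π ℚ.+ sumℚ (map f πs)                           ≤⟨ ℚ.+-mono-≤ fπ≤ (sumℚ-≤ 0<b πs fπs≤) ⟩
  frac (+ W) b ℚ.+ frac (+ (length πs * W)) b       ≡⟨ frac-+ (+ W) (+ (length πs * W)) 0<b ⟩
  frac (+ (W + length πs * W)) b                    ∎
  where open ℚ.≤-Reasoning

0≤sumℚ-∣∣ : ∀ (g : List ℕ → ℚ) πs → 0ℚ ℚ.≤ sumℚ (map (λ π → ℚ.∣ g π ∣) πs)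
0≤sumℚ-∣∣ g []       = ℚ.≤-refl
0≤sumℚ-∣∣ g (π ∷ πs) = ℚ.+-mono-≤ (ℚ.0≤∣p∣ (g π)) (0≤sumℚ-∣∣ g πs)

tvDist-nonNeg : ∀ n P Q → 0ℚ ℚ.≤ tvDist n P Q
tvDist-nonNeg n P Q = ℚ.≤-trans (ℚ.≤-reflexive (sym (ℚ.*-zeroʳ (frac (+ 1) 2))))
  (ℚ.*-monoˡ-≤-nonNeg (frac (+ 1) 2) (0≤sumℚ-∣∣ (λ π → P π ℚ.- Q π) (Sn n)))

tvDist-≤ : ∀ n P Q {W b} → 0 < b → All (λ π → ℚ.∣ P π ℚ.- Q π ∣ ℚ.≤ frac (+ W) b) (Sn n) →
           tvDist n P Q ℚ.≤ frac (+ (n ! * W)) (2 * b)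
tvDist-≤ n P Q {W} {b} 0<b bounds = begin
  frac (+ 1) 2 ℚ.* sumℚ (map (λ π → ℚ.∣ P π ℚ.- Q π ∣) (Sn n))
    ≤⟨ ℚ.*-monoˡ-≤-nonNeg (frac (+ 1) 2) (sumℚ-≤ 0<b (Sn n) bounds) ⟩
  frac (+ 1) 2 ℚ.* frac (+ (length (Sn n) * W)) b
    ≤⟨ ℚ.*-monoˡ-≤-nonNeg (frac (+ 1) 2) (frac-monoˡ-≤ 0<b (*-monoˡ-≤ W (length-Sn≤n! n))) ⟩
  frac (+ 1) 2 ℚ.* frac (+ (n ! * W)) b
    ≡⟨ frac-* {1} {n ! * W} {2} {b} (s≤s z≤n) 0<b ⟩
  frac (+ (1 * (n ! * W))) (2 * b)
    ≡⟨ cong (λ a → frac (+ a) (2 * b)) (*-identityˡ (n ! * W)) ⟩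
  frac (+ (n ! * W)) (2 * b) ∎
  where open ℚ.≤-Reasoning

^ℚ2-mono : ∀ {x z} → 0ℚ ℚ.≤ x → x ℚ.≤ z → x ^ℚ 2 ℚ.≤ z ^ℚ 2
^ℚ2-mono {x} {z} 0≤x x≤z = begin
  x ℚ.* (x ℚ.* 1ℚ) ≡⟨ cong (x ℚ.*_) (ℚ.*-identityʳ x) ⟩
  x ℚ.* x          ≤⟨ ℚ.*-monoˡ-≤-nonNeg x {{ℚ.nonNegative 0≤x}} x≤z ⟩
  x ℚ.* z          ≤⟨ ℚ.*-monoʳ-≤-nonNeg z {{ℚ.nonNegative (ℚ.≤-trans 0≤x x≤z)}} x≤z ⟩
  z ℚ.* z          ≡⟨ cong (z ℚ.*_) (ℚ.*-identityʳ z) ⟨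
  z ℚ.* (z ℚ.* 1ℚ) ∎
  where open ℚ.≤-Reasoning

-- eUpper 3 = 1 + 1 + 1/2 + 1/6 + 1/18 = 49/18.
LtBound-intro : ∀ {n k x} a b → 0 < b → 0ℚ ℚ.≤ x → x ℚ.≤ frac (+ a) b →
                a ^ 2 * (49 * k) ^ n < (n ^ 2 * (2 * n) ^ n) * (b ^ 2 * 18 ^ n) → LtBound n k x
LtBound-intro {n} {k} {x} a b 0<b 0≤x x≤a/b ineq = 3 , s≤s z≤n , (begin-strict
  x ^ℚ 2 ℚ.* E
    ≤⟨ ℚ.*-monoʳ-≤-nonNeg E {{ℚ.nonNegative 0≤E}} (^ℚ2-mono 0≤x x≤a/b) ⟩
  frac (+ a) b ^ℚ 2 ℚ.* E
    ≡⟨ cong₂ ℚ._*_ (frac-^ a 0<b 2) E≡ ⟩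
  frac (+ (a ^ 2)) (b ^ 2) ℚ.* frac (+ ((49 * k) ^ n)) (18 ^ n)
    ≡⟨ frac-* 0<b² 0<18ⁿ ⟩
  frac (+ (a ^ 2 * (49 * k) ^ n)) (b ^ 2 * 18 ^ n)
    <⟨ frac-< {a ^ 2 * (49 * k) ^ n} {n ^ 2 * (2 * n) ^ n} (*-mono-≤ 0<b² 0<18ⁿ) (s≤s z≤n)
         (subst (_< (n ^ 2 * (2 * n) ^ n) * (b ^ 2 * 18 ^ n)) (sym (*-identityʳ (a ^ 2 * (49 * k) ^ n))) ineq) ⟩
  frac (+ (n ^ 2 * (2 * n) ^ n)) 1 ∎)
  where
  open ℚ.≤-Reasoning
  E = (eUpper 3 ℚ.* frac (+ k) 1) ^ℚ n
  0<b² = m^n>0 b {{>-nonZero 0<b}} 2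
  0<18ⁿ = m^n>0 18 n
  E≡ : E ≡ frac (+ ((49 * k) ^ n)) (18 ^ n)
  E≡ = trans (cong (_^ℚ n) (frac-* {49} {k} {18} {1} (s≤s z≤n) (s≤s z≤n))) (frac-^ (49 * k) (s≤s z≤n) n)
  0≤E : 0ℚ ℚ.≤ E
  0≤E = subst (0ℚ ℚ.≤_) (sym E≡) (ℚ.≤-trans (ℚ.≤-reflexive (sym (frac-zero 0<18ⁿ))) (frac-monoˡ-≤ 0<18ⁿ z≤n))

-- Numerical inequalities

termBound-≤ : ∀ {n r} → 1 ≤ n → 2 ≤ r → termBound n r ≤ 2 ^ suc n
termBound-≤ {n} {suc r} 1≤n 2≤r = if-does (_≤ 2 ^ suc n) (suc r ∣? n) divisorCase (λ _ → z≤n)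
  where
  R = suc r
  divisorCase : R ∣ n → (2 ^ R ∸ 1) * oddBinomial (n / R ∸ 1) ≤ 2 ^ suc n
  divisorCase (divides zero n≡0)     = ⊥-elim (<⇒≢ 1≤n (sym n≡0))
  divisorCase (divides (suc u) n≡) = begin
    (2 ^ R ∸ 1) * oddBinomial (n / R ∸ 1) ≡⟨ cong (λ v → (2 ^ R ∸ 1) * oddBinomial v) quotient ⟩
    (2 ^ R ∸ 1) * oddBinomial u           ≤⟨ *-mono-≤ (m∸n≤m (2 ^ R) 1) (C≤2^ (u + suc u) u) ⟩
    2 ^ R * 2 ^ (u + suc u)               ≡⟨ ^-distribˡ-+-* 2 R (u + suc u) ⟨
    2 ^ (R + (u + suc u))                 ≤⟨ ^-monoʳ-≤ 2 exponent ⟩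
    2 ^ suc n                             ∎
    where
    open ≤-Reasoning
    quotient : n / R ∸ 1 ≡ u
    quotient = cong (_∸ 1) (trans (cong (_/ R) n≡) (m*n/n≡m (suc u) R))
    exponent : R + (u + suc u) ≤ suc n
    exponent = begin
      R + (u + suc u)   ≡⟨ twice R u ⟩
      suc (R + u * 2)   ≤⟨ s≤s (+-monoʳ-≤ R (*-monoʳ-≤ u 2≤r)) ⟩
      suc (R + u * R)   ≡⟨ cong suc n≡ ⟨
      suc n             ∎
      where
      twice : ∀ R u → R + (u + suc u) ≡ suc (R + u * 2)
      twice = solve-∀

discrepancyBound-≤ : ∀ {n} → 1 ≤ n → discrepancyBound n ≤ n * 2 ^ suc n
discrepancyBound-≤ {suc m} 1≤n = ⊔-lub (m≤m*n (suc m) (2 ^ suc (suc m)) {{m^n≢0 2 (suc (suc m))}}) (begin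
  sum (map (termBound n) (drop 1 (oneTo n)))   ≤⟨ sum-≤-length* (drop 1 (oneTo n)) termBounds ⟩
  length (drop 1 (oneTo n)) * 2 ^ suc n       ≡⟨ cong (_* 2 ^ suc n) (cong (_∸ 1) (length-oneTo n)) ⟩
  m * 2 ^ suc n                                ≤⟨ *-monoˡ-≤ (2 ^ suc n) (n≤1+n m) ⟩
  n * 2 ^ suc n                                ∎)
  where
  open ≤-Reasoning
  n = suc m
  termBounds : All (λ r → termBound n r ≤ 2 ^ suc n) (drop 1 (oneTo n))
  termBounds = All-drop-1-oneTo n (termBound-≤ 1≤n)

bernoulli-second-order : ∀ n m → n ^ m * (2 * n * n + 2 * m * n + m * m) ≤ suc n ^ m * (2 * n * n) + m * n ^ m
bernoulli-second-order n zero    = ≤-reflexive (base n)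
  where
  base : ∀ n → 1 * (2 * n * n + 2 * 0 * n + 0 * 0) ≡ 1 * (2 * n * n) + 0 * 1
  base = solve-∀
bernoulli-second-order n (suc m) = +-cancelʳ-≤ (suc n * m * N) _ _ (begin
  n * N * (2 * n * n + 2 * suc m * n + suc m * suc m) + suc n * m * N
    ≡⟨ expand₁ n m N ⟩
  Z + N * m
    ≤⟨ +-monoʳ-≤ Z (*-monoʳ-≤ N (m≤m*m m)) ⟩
  Z + N * (m * m)
    ≡⟨ expand₂ n m N ⟩
  suc n * (N * (2 * n * n + 2 * m * n + m * m)) + suc m * (n * N)
    ≤⟨ +-monoˡ-≤ _ (*-monoʳ-≤ (suc n) (bernoulli-second-order n m)) ⟩
  suc n * (suc n ^ m * (2 * n * n) + m * N) + suc m * (n * N)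
    ≡⟨ expand₃ n m N (suc n ^ m) ⟩
  suc n * suc n ^ m * (2 * n * n) + suc m * (n * N) + suc n * m * N ∎)
  where
  open ≤-Reasoning
  N = n ^ m
  Z = N * (2 * n * n * n + 2 * m * n * n + 2 * n * n + m * m * n + 2 * m * n + n + m * n)
  m≤m*m : ∀ m → m ≤ m * m
  m≤m*m zero    = z≤n
  m≤m*m (suc m) = m≤m*n (suc m) (suc m)
  expand₁ : ∀ n m N → n * N * (2 * n * n + 2 * suc m * n + suc m * suc m) + suc n * m * N
            ≡ N * (2 * n * n * n + 2 * m * n * n + 2 * n * n + m * m * n + 2 * m * n + n + m * n) + N * m
  expand₁ = solve-∀
  expand₂ : ∀ n m N → N * (2 * n * n * n + 2 * m * n * n + 2 * n * n + m * m * n + 2 * m * n + n + m * n) + N * (m * m)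
            ≡ suc n * (N * (2 * n * n + 2 * m * n + m * m)) + suc m * (n * N)
  expand₂ = solve-∀
  expand₃ : ∀ n m N A → suc n * (A * (2 * n * n) + m * N) + suc m * (n * N)
            ≡ suc n * A * (2 * n * n) + suc m * (n * N) + suc n * m * N
  expand₃ = solve-∀

compound-interest-lower : ∀ n → 5 * n * n ^ n ≤ 2 * n * suc n ^ n + n ^ n
compound-interest-lower zero    = z≤n
compound-interest-lower (suc m) = *-cancelˡ-≤ n (begin
  n * (5 * n * N)                          ≡⟨ expand₁ n N ⟩
  N * (2 * n * n + 2 * n * n + n * n)      ≤⟨ bernoulli-second-order n n ⟩
  suc n ^ n * (2 * n * n) + n * N          ≡⟨ expand₂ n N (suc n ^ n) ⟩
  n * (2 * n * suc n ^ n + N)              ∎)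
  where
  open ≤-Reasoning
  n = suc m
  N = n ^ n
  expand₁ : ∀ n N → n * (5 * n * N) ≡ N * (2 * n * n + 2 * n * n + n * n)
  expand₁ = solve-∀
  expand₂ : ∀ n N X → X * (2 * n * n) + n * N ≡ n * (2 * n * X + N)
  expand₂ = solve-∀

-- (1 + 1/n)^(2n) ≥ (49/9)(1 + 1/n). It is proved for n = 10 + t, so that 5n − 1 = 49 + 5t
-- involves no truncated subtraction.
compound-interest-bound : ∀ n → 10 ≤ n → 49 * suc n * (n ^ n * n ^ n) ≤ 9 * n * (suc n ^ n * suc n ^ n)
compound-interest-bound m 10≤m = subst Goal (m+[n∸m]≡n 10≤m) (shifted (m ∸ 10))
  where
  Goal : ℕ → Set
  Goal n = 49 * suc n * (n ^ n * n ^ n) ≤ 9 * n * (suc n ^ n * suc n ^ n)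
  shifted : ∀ t → Goal (10 + t)
  shifted t = *-cancelˡ-≤ (4 * n * n) (begin
    4 * n * n * (49 * suc n * (N * N))       ≡⟨ rearrange₁ n N ⟩
    196 * n * n * suc n * (N * N)            ≤⟨ *-monoˡ-≤ (N * N) coefficients ⟩
    9 * n * a * a * (N * N)                  ≡⟨ rearrange₂ n a N ⟩
    9 * n * (a * N) * (a * N)                ≤⟨ *-mono-≤ (*-monoʳ-≤ (9 * n) aN≤2nX) aN≤2nX ⟩
    9 * n * (2 * n * X) * (2 * n * X)        ≡⟨ rearrange₃ n X ⟩
    4 * n * n * (9 * n * (X * X))            ∎)
    where
    open ≤-Reasoning
    n = 10 + t
    N = n ^ n
    X = suc n ^ n
    a = 49 + 5 * t
    aN≤2nX : a * N ≤ 2 * n * X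
    aN≤2nX = +-cancelʳ-≤ N _ _ (≤-trans (≤-reflexive (five t N)) (compound-interest-lower n))
      where
      five : ∀ t N → (49 + 5 * t) * N + N ≡ 5 * (10 + t) * N
      five = solve-∀
    coefficients : 196 * n * n * suc n ≤ 9 * n * a * a
    coefficients = ≤-trans (m≤m+n _ ((10 + t) * (49 + 294 * t + 29 * t * t))) (≤-reflexive (gap t))
      where
      gap : ∀ t → 196 * (10 + t) * (10 + t) * suc (10 + t) + (10 + t) * (49 + 294 * t + 29 * t * t)
                  ≡ 9 * (10 + t) * (49 + 5 * t) * (49 + 5 * t)
      gap = solve-∀
    rearrange₁ : ∀ n N → 4 * n * n * (49 * suc n * (N * N)) ≡ 196 * n * n * suc n * (N * N)
    rearrange₁ = solve-∀
    rearrange₂ : ∀ n a N → 9 * n * a * a * (N * N) ≡ 9 * n * (a * N) * (a * N)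
    rearrange₂ = solve-∀
    rearrange₃ : ∀ n X → 9 * n * (2 * n * X) * (2 * n * X) ≡ 4 * n * n * (9 * n * (X * X))
    rearrange₃ = solve-∀

FactorialBound : ℕ → Set
FactorialBound n = n ! * n ! * n * 49 ^ n < n ^ n * n ^ n * 9 ^ n

factorialBound-step : ∀ n → 10 ≤ n → FactorialBound n → FactorialBound (suc n)
factorialBound-step n 10≤n ih = *-cancelˡ-< n _ _ (begin-strict
  n * (suc n * F * (suc n * F) * suc n * (49 * Q))    ≡⟨ rearrange₁ n F Q ⟩
  (suc n * suc n * suc n * 49) * (F * F * n * Q)      <⟨ *-monoʳ-< (suc n * suc n * suc n * 49) ih ⟩
  (suc n * suc n * suc n * 49) * (N * N * R)          ≡⟨ rearrange₂ n N R ⟩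
  (suc n * suc n * R) * (49 * suc n * (N * N))        ≤⟨ *-monoʳ-≤ (suc n * suc n * R) (compound-interest-bound n 10≤n) ⟩
  (suc n * suc n * R) * (9 * n * (X * X))             ≡⟨ rearrange₃ n X R ⟩
  n * (suc n * X * (suc n * X) * (9 * R))             ∎)
  where
  open ≤-Reasoning
  F = n !
  Q = 49 ^ n
  R = 9 ^ n
  N = n ^ n
  X = suc n ^ n
  rearrange₁ : ∀ n F Q → n * (suc n * F * (suc n * F) * suc n * (49 * Q)) ≡ (suc n * suc n * suc n * 49) * (F * F * n * Q)
  rearrange₁ = solve-∀
  rearrange₂ : ∀ n N R → (suc n * suc n * suc n * 49) * (N * N * R) ≡ (suc n * suc n * R) * (49 * suc n * (N * N))
  rearrange₂ = solve-∀
  rearrange₃ : ∀ n X R → (suc n * suc n * R) * (9 * n * (X * X)) ≡ n * (suc n * X * (suc n * X) * (9 * R))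
  rearrange₃ = solve-∀

factorialBound : ∀ n → 28 ≤ n → FactorialBound n
factorialBound (suc m) 28≤1+m with m≤n⇒m<n∨m≡n 28≤1+m
... | inj₂ 28≡1+m     = subst FactorialBound 28≡1+m (toWitness {a? = _ <? _} _)
... | inj₁ (s≤s 28≤m) = factorialBound-step m (≤-trans (m≤n+m 10 18) 28≤m) (factorialBound m 28≤m)

suc≤4+2*correctionDegree : ∀ n → 2 ≤ n → suc n ≤ 4 + 2 * correctionDegree n
suc≤4+2*correctionDegree n 2≤n = begin
  suc n                            ≡⟨ cong suc (m≡m%n+[m/n]*n n 2) ⟩
  suc (n % 2 + n / 2 * 2)          ≤⟨ s≤s (+-monoˡ-≤ (n / 2 * 2) (≤-pred (m%n<n n 2))) ⟩
  suc (1 + n / 2 * 2)              ≡⟨ cong (λ h → suc (1 + h * 2)) (m∸n+n≡m (m≥n⇒m/n>0 {n} {2} 2≤n)) ⟨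
  suc (1 + (correctionDegree n + 1) * 2) ≡⟨ expand (correctionDegree n) ⟩
  4 + 2 * correctionDegree n       ∎
  where
  open ≤-Reasoning
  expand : ∀ d → suc (1 + (d + 1) * 2) ≡ 4 + 2 * d
  expand = solve-∀

-- The theorem with e replaced by 49/18, after summing the pointwise bound and cancelling the
-- powers of k.
NumericBound : ℕ → Set
NumericBound n = (n !) ^ 2 * discrepancyBound n ^ 2 * 49 ^ n < 4 * n ^ (4 + 2 * correctionDegree n) * (2 * n) ^ n * 18 ^ n

numericBound-small : ∀ n → 2 ≤ n → n < 28 → NumericBound n
numericBound-small n 2≤n n<28 = subst NumericBound n≡ (cases (fromℕ< (∸-monoˡ-< n<28 2≤n)))
  where
  cases : ∀ (i : Fin 26) → NumericBound (2 + toℕ i)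
  cases = toWitness {a? = Fin.all? (λ i → _ <? _)} _
  n≡ : 2 + toℕ (fromℕ< (∸-monoˡ-< n<28 2≤n)) ≡ n
  n≡ = trans (cong (_+_ 2) (Fin.toℕ-fromℕ< _)) (m+[n∸m]≡n 2≤n)

numericBound-large : ∀ n → 28 ≤ n → NumericBound n
numericBound-large n 28≤n = begin-strict
  F * (F * 1) * (V * (V * 1)) * Q
    ≤⟨ *-monoˡ-≤ Q (*-monoʳ-≤ (F * (F * 1)) (*-mono-≤ V≤ (*-monoˡ-≤ 1 V≤))) ⟩
  F * (F * 1) * (n * (2 * P) * (n * (2 * P) * 1)) * Q
    ≡⟨ rearrange₁ F n P Q ⟩
  (4 * n * P * P) * (F * F * n * Q)
    <⟨ *-monoʳ-< (4 * n * P * P) {{>-nonZero 0<4nPP}} (factorialBound n 28≤n) ⟩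
  (4 * n * P * P) * (N * N * R)
    ≡⟨ rearrange₂ n P N R ⟩
  4 * (n * N) * (P * N) * (P * R)
    ≤⟨ *-monoˡ-≤ (P * R) (*-monoˡ-≤ (P * N) (*-monoʳ-≤ 4 n^[1+n]≤)) ⟩
  4 * n ^ (4 + 2 * correctionDegree n) * (P * N) * (P * R)
    ≡⟨ cong₂ (λ a b → 4 * n ^ (4 + 2 * correctionDegree n) * a * b) (*-^-distrib 2 n n) (*-^-distrib 2 9 n) ⟨
  4 * n ^ (4 + 2 * correctionDegree n) * (2 * n) ^ n * 18 ^ n ∎
  where
  open ≤-Reasoning
  F = n !
  V = discrepancyBound n
  Q = 49 ^ n
  P = 2 ^ n
  N = n ^ n
  R = 9 ^ n
  2≤n = ≤-trans (m≤n+m 2 26) 28≤n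
  0<n = ≤-trans (s≤s z≤n) 2≤n
  n^[1+n]≤ : n ^ suc n ≤ n ^ (4 + 2 * correctionDegree n)
  n^[1+n]≤ = ^-monoʳ-≤ n {{>-nonZero 0<n}} (suc≤4+2*correctionDegree n 2≤n)
  V≤ : V ≤ n * (2 * P)
  V≤ = discrepancyBound-≤ 0<n
  0<4nPP : 0 < 4 * n * P * P
  0<4nPP = *-mono-< (*-mono-< (*-mono-< {0} {4} (s≤s z≤n) 0<n) (m^n>0 2 n)) (m^n>0 2 n)
  rearrange₁ : ∀ F n P Q → F * (F * 1) * (n * (2 * P) * (n * (2 * P) * 1)) * Q ≡ (4 * n * P * P) * (F * F * n * Q)
  rearrange₁ = solve-∀
  rearrange₂ : ∀ n P N R → (4 * n * P * P) * (N * N * R) ≡ 4 * (n * N) * (P * N) * (P * R)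
  rearrange₂ = solve-∀

numericBound : ∀ n → 2 ≤ n → NumericBound n
numericBound n 2≤n with 28 ≤? n
... | yes 28≤n = numericBound-large n 28≤n
... | no  28≰n = numericBound-small n 2≤n (≰⇒> 28≰n)

2*correctionDegree+n≤2*[n∸1] : ∀ n → 2 ≤ n → 2 * correctionDegree n + n ≤ 2 * (n ∸ 1)
2*correctionDegree+n≤2*[n∸1] n@(suc m) 2≤n = +-cancelʳ-≤ 2 _ _ (begin
  2 * d + n + 2          ≡⟨ expand₁ d n ⟩
  n + (d + 1) * 2        ≡⟨ cong (λ h → n + h * 2) (m∸n+n≡m (m≥n⇒m/n>0 {n} {2} 2≤n)) ⟩
  n + n / 2 * 2          ≤⟨ +-monoʳ-≤ n (m/n*n≤m n 2) ⟩
  n + n                  ≡⟨ expand₂ m ⟩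
  2 * m + 2              ∎)
  where
  open ≤-Reasoning
  d = correctionDegree n
  expand₁ : ∀ d n → 2 * d + n + 2 ≡ n + (d + 1) * 2
  expand₁ = solve-∀
  expand₂ : ∀ m → suc m + suc m ≡ 2 * m + 2
  expand₂ = solve-∀

numericBound-k : ∀ n k → 2 ≤ n → n ≤ k →
  (n ! * (k ^ correctionDegree n * discrepancyBound n)) ^ 2 * (49 * k) ^ n
    < (n ^ 2 * (2 * n) ^ n) * ((2 * (n ^ correctionDegree n * normaliser n k)) ^ 2 * 18 ^ n)
numericBound-k n k 2≤n n≤k = begin-strict
  (F * (Kᵈ * V)) ^ 2 * (49 * k) ^ n
    ≡⟨ cong ((F * (Kᵈ * V)) ^ 2 *_) (*-^-distrib 49 k n) ⟩
  (F * (Kᵈ * V)) ^ 2 * (49 ^ n * k ^ n)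
    ≡⟨ rearrange₁ F Kᵈ V (49 ^ n) (k ^ n) ⟩
  F ^ 2 * V ^ 2 * 49 ^ n * (Kᵈ * Kᵈ * k ^ n)
    ≤⟨ *-monoʳ-≤ (F ^ 2 * V ^ 2 * 49 ^ n) k-powers ⟩
  F ^ 2 * V ^ 2 * 49 ^ n * (K * K)
    <⟨ *-monoˡ-< (K * K) {{>-nonZero 0<K²}} (numericBound n 2≤n) ⟩
  4 * n ^ (4 + 2 * d) * (2 * n) ^ n * 18 ^ n * (K * K)
    ≡⟨ cong (λ t → 4 * (n * (n * (n * (n * t)))) * (2 * n) ^ n * 18 ^ n * (K * K)) (^-double n d) ⟩
  4 * (n * (n * (n * (n * (Nᵈ * Nᵈ))))) * (2 * n) ^ n * 18 ^ n * (K * K)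
    ≡⟨ rearrange₂ n Nᵈ K ((2 * n) ^ n) (18 ^ n) ⟩
  (n ^ 2 * (2 * n) ^ n) * ((2 * (Nᵈ * (n * K))) ^ 2 * 18 ^ n) ∎
  where
  open ≤-Reasoning
  d = correctionDegree n
  F = n !
  V = discrepancyBound n
  Kᵈ = k ^ d
  Nᵈ = n ^ d
  K = k ^ (n ∸ 1)
  0<k = ≤-trans (≤-trans (s≤s z≤n) 2≤n) n≤k
  0<K² : 0 < K * K
  0<K² = *-mono-< (m^n>0 k {{>-nonZero 0<k}} (n ∸ 1)) (m^n>0 k {{>-nonZero 0<k}} (n ∸ 1))
  k-powers : Kᵈ * Kᵈ * k ^ n ≤ K * K
  k-powers = begin
    Kᵈ * Kᵈ * k ^ n                  ≡⟨ cong (_* k ^ n) (^-double k d) ⟨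
    k ^ (2 * d) * k ^ n              ≡⟨ ^-distribˡ-+-* k (2 * d) n ⟨
    k ^ (2 * d + n)                  ≤⟨ ^-monoʳ-≤ k {{>-nonZero 0<k}} (2*correctionDegree+n≤2*[n∸1] n 2≤n) ⟩
    k ^ (2 * (n ∸ 1))                ≡⟨ ^-double k (n ∸ 1) ⟩
    K * K                            ∎
  rearrange₁ : ∀ f x v q y → f * (x * v) * (f * (x * v) * 1) * (q * y) ≡ f * (f * 1) * (v * (v * 1)) * q * (x * x * y)
  rearrange₁ = solve-∀
  rearrange₂ : ∀ n x y t e → 4 * (n * (n * (n * (n * (x * x))))) * t * e * (y * y)
                            ≡ (n * (n * 1) * t) * ((2 * (x * (n * y))) * ((2 * (x * (n * y))) * 1) * e)
  rearrange₂ = solve-∀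

mainTheorem6 : (n k : ℕ) → 1 ≤ n → n ≤ k →
    LtBound n k (tvDist n (affineShuffle k n) (cutShuffle k n))
mainTheorem6 zero          k       ()  _
mainTheorem6 (suc zero)    zero    _   ()
-- For n = 1 there are no correction terms and the only permutation has no cyclic descent, so A = C.
mainTheorem6 (suc zero)    (suc k) 1≤n n≤k =
  LtBound-intro {1} {suc k} 0 2 (s≤s z≤n) (tvDist-nonNeg 1 affine cut)
    (tvDist-≤ 1 affine cut {0} {1} (s≤s z≤n) (affine-cut-below (0 ∷ []) 1≤n n≤k (s≤s z≤n) ∷ []))
    (s≤s z≤n)
  where
  affine = affineShuffle (suc k) 1
  cut = cutShuffle (suc k) 1
mainTheorem6 n@(suc (suc _)) k 1≤n n≤k =
  LtBound-intro {n} {k} (n ! * (k ^ d * discrepancyBound n)) (2 * (n ^ d * normaliser n k))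
    (*-mono-≤ {1} {2} (s≤s z≤n) (0<nᵈ*normaliser 1≤n n≤k)) (tvDist-nonNeg n affine cut)
    (tvDist-≤ n affine cut (0<nᵈ*normaliser 1≤n n≤k) (All.universal (λ π → ∣affine-cut∣≤ π 1≤n n≤k) (Sn n)))
    (numericBound-k n k (s≤s (s≤s z≤n)) n≤k)
  where
  d = correctionDegree n
  affine = affineShuffle k n
  cut = cutShuffle k n
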